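{- Let $C_n$ be the cycle graph of order $n\ge 3$. If $n$ is odd, then $C_n$ is $(n-1)$-metric dimensional, and if $n$ is even, then $C_n$ is $(n-2)$-metric dimensional.
   Context: For a connected graph with shortest-path distance $d$: a set $S$ of vertices is a $k$-metric generator if every pair of distinct vertices $x,y$ has at least $k$ elements $w\in S$ with $d(x,w)\ne d(y,w)$; the graph is $k$-metric dimensional if $k$ is the largest integer for which a $k$-metric generator exists. -}

module Defs where

open import Data.Nat using (ℕ; zero; suc; _≤_; _+_; _*_)
open import Data.Nat.Properties using (_≟_)
open import Data.Fin using (Fin; toℕ)
open import Data.Fin.Subset using (Subset; _∈_)
open import Data.Fin.Subset.Properties using (_∈?_)
open import Data.List using (List; length; filter; allFin)
open import Data.Product using (Σ; _×_; _,_)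
open import Data.Sum using (_⊎_)
open import Relation.Nullary using (¬_; Dec; _×-dec_; ¬?)
open import Relation.Binary.PropositionalEquality using (_≡_)

Graph : ℕ → Set₁
Graph n = Fin n → Fin n → Set

data Walk {n : ℕ} (G : Graph n) : Fin n → Fin n → ℕ → Set where
  [] : ∀ {x} → Walk G x x 0
  _∷_ : ∀ {x y z m} → G x y → Walk G y z m → Walk G x z (suc m)

-- d is the shortest-path distance of G: d x y is the length of some walk
-- from x to y, and no walk from x to y is shorter.
-- (Existence of such d for all x y also expresses that G is connected.)
IsDistance : ∀ {n} → Graph n → (Fin n → Fin n → ℕ) → Set
IsDistance {n} G d =
  ∀ (x y : Fin n) → Walk G x y (d x y) × (∀ m → Walk G x y m → d x y ≤ m)

CycleAdj : (n : ℕ) → Graph n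
CycleAdj n x y =
  (suc (toℕ x) ≡ toℕ y) ⊎ (suc (toℕ y) ≡ toℕ x)
  ⊎ ((toℕ x ≡ 0 × suc (toℕ y) ≡ n) ⊎ (toℕ y ≡ 0 × suc (toℕ x) ≡ n))

#resolving : ∀ {n} → (Fin n → Fin n → ℕ) → Subset n → Fin n → Fin n → ℕ
#resolving {n} d S x y =
  length (filter (λ w → (w ∈? S) ×-dec ¬? (d x w ≟ d y w)) (allFin n))

IsKMetricGenerator : ∀ {n} → (Fin n → Fin n → ℕ) → ℕ → Subset n → Set
IsKMetricGenerator {n} d k S =
  ∀ (x y : Fin n) → ¬ (x ≡ y) → k ≤ #resolving d S x y

IsKMetricDimensional : ∀ {n} → (Fin n → Fin n → ℕ) → ℕ → Set
IsKMetricDimensional {n} d k =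
  Σ (Subset n) (IsKMetricGenerator d k)
  × (∀ (k' : ℕ) (S : Subset n) → IsKMetricGenerator d k' S → k' ≤ k)

module Submission where

-- On vertices 0, …, n-1 the shortest-path distance is
--    cycleDist n a b = min(|a-b|, n-|a-b|): both arcs are realised by walks,
--    and along any edge cycleDist changes by at most one, so no walk is
--    shorter.  Hence every shortest-path distance of C_n equals cycleDist.
-- 2. Midpoints.  If distinct a, b are equidistant from w, then w halves one of
--    the two arcs between them: 2w ≡ a + b (mod n).  Two such w coincide or are
--    antipodal (2w₁ and 2w₂ differ by n); antipodes do not exist for odd n and
--    are unique for any n.  So x ≠ y have at most one equidistant vertex when n
--    is odd and at most two in general.
-- 3. Counting.  #resolving d S x y is n minus the number of vertices left
--    unresolved.  If every pair has at most r unresolved vertices for S = ⊤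
--    while one pair has at least r for every S, the graph is
--    (n-r)-metric dimensional.
-- 4. The pair {0, 2} has the equidistant vertex 1 and, for n = 2m, also m + 1;
--    combined with step 2 this gives r = 1 for odd n and r = 2 for even n,
--    and proposition7 assembles steps 1 and 4.

open import Defs
open import Data.Nat
open import Data.Nat.Properties
open import Data.Nat.Tactic.RingSolver using (solve-∀)
open import Data.Fin using (Fin; toℕ; fromℕ; fromℕ<) renaming (zero to fzero; suc to fsuc)
open import Data.Fin.Properties using (toℕ-injective; toℕ<n; toℕ-fromℕ<; toℕ-fromℕ)
open import Data.Fin.Subset using (Subset; ⊤) renaming (_∈_ to _∈ₛ_)
open import Data.Fin.Subset.Properties using (_∈?_; ∈⊤)
open import Data.List using (List; []; _∷_; length; filter; allFin)
open import Data.List.Properties using (length-tabulate)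
open import Data.List.Relation.Unary.All using (All; _∷_)
open import Data.List.Relation.Unary.All.Properties using (all-filter)
open import Data.List.Relation.Unary.AllPairs using (_∷_)
open import Data.List.Relation.Unary.Any using (here; there)
open import Data.List.Relation.Unary.Unique.Propositional using (Unique)
open import Data.List.Relation.Unary.Unique.Propositional.Properties using (allFin⁺; filter⁺)
open import Data.List.Membership.Propositional using (_∈_)
open import Data.List.Membership.Propositional.Properties using (∈-filter⁺; ∈-allFin)
open import Data.Product using (Σ; _×_; _,_; proj₁; proj₂)
open import Data.Sum using (_⊎_; inj₁; inj₂) renaming (map to ⊎-map)
open import Data.Empty using (⊥-elim)
open import Relation.Nullary using (¬_; yes; no; ¬?; _×-dec_; contradiction)
open import Relation.Nullary.Decidable using (decidable-stable)
open import Relation.Unary using (Pred; Decidable; ∁)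
open import Relation.Unary.Properties using (∁?)
open import Relation.Binary.PropositionalEquality

cycleDist : ℕ → ℕ → ℕ → ℕ
cycleDist n a b = ∣ a - b ∣ ⊓ (n ∸ ∣ a - b ∣)

∣-∣-cases : ∀ a b → a ≡ b + ∣ a - b ∣ ⊎ b ≡ a + ∣ a - b ∣
∣-∣-cases zero    b       = inj₂ refl
∣-∣-cases (suc a) zero    = inj₁ refl
∣-∣-cases (suc a) (suc b) with ∣-∣-cases a b
... | inj₁ e = inj₁ (cong suc e)
... | inj₂ e = inj₂ (cong suc e)

∸-step : ∀ n {p q} → q ≤ suc p → n ∸ p ≤ suc (n ∸ q)
∸-step n {p} {q} q≤1+p = m≤n+o⇒m∸n≤o n p (begin
  n                 ≤⟨ m≤n+m∸n n q ⟩
  q + (n ∸ q)       ≤⟨ +-monoˡ-≤ (n ∸ q) q≤1+p ⟩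
  suc p + (n ∸ q)   ≡⟨ sym (+-suc p (n ∸ q)) ⟩
  p + suc (n ∸ q)   ∎)
  where open ≤-Reasoning

⊓-complement-step : ∀ n {p q} → p ≤ suc q → q ≤ suc p →
                    p ⊓ (n ∸ p) ≤ suc (q ⊓ (n ∸ q))
⊓-complement-step n p≤1+q q≤1+p = ⊓-mono-≤ p≤1+q (∸-step n q≤1+p)

-- The two arcs exchange roles when moving across the edge closing the cycle.
⊓-swap-step : ∀ x y → x ⊓ suc y ≤ suc (y ⊓ suc x)
⊓-swap-step x y = begin
  x ⊓ suc y             ≡⟨ ⊓-comm x (suc y) ⟩
  suc y ⊓ x             ≤⟨ ⊓-monoʳ-≤ (suc y) (≤-trans (n≤1+n x) (n≤1+n (suc x))) ⟩
  suc y ⊓ suc (suc x)   ∎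
  where open ≤-Reasoning

∣a-1+a∣≡1 : ∀ a → ∣ a - suc a ∣ ≡ 1
∣a-1+a∣≡1 a = trans (m≤n⇒∣m-n∣≡n∸m (n≤1+n a)) (m+n∸n≡m 1 a)

∣1+a-a∣≡1 : ∀ a → ∣ suc a - a ∣ ≡ 1
∣1+a-a∣≡1 a = trans (∣-∣-comm (suc a) a) (∣a-1+a∣≡1 a)

cycleDist-succ : ∀ n a c → cycleDist n a c ≤ suc (cycleDist n (suc a) c)
cycleDist-succ n a c = ⊓-complement-step n
  (subst (λ t → ∣ a - c ∣ ≤ t + ∣ suc a - c ∣) (∣a-1+a∣≡1 a) (∣-∣-triangle a (suc a) c))
  (subst (λ t → ∣ suc a - c ∣ ≤ t + ∣ a - c ∣) (∣1+a-a∣≡1 a) (∣-∣-triangle (suc a) a c))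

cycleDist-pred : ∀ n a c → cycleDist n (suc a) c ≤ suc (cycleDist n a c)
cycleDist-pred n a c = ⊓-complement-step n
  (subst (λ t → ∣ suc a - c ∣ ≤ t + ∣ a - c ∣) (∣1+a-a∣≡1 a) (∣-∣-triangle (suc a) a c))
  (subst (λ t → ∣ a - c ∣ ≤ t + ∣ suc a - c ∣) (∣a-1+a∣≡1 a) (∣-∣-triangle a (suc a) c))

cycleDist-from-0 : ∀ {k c} → c ≤ k → cycleDist (suc k) 0 c ≡ c ⊓ suc (k ∸ c)
cycleDist-from-0 {c = c} c≤k = cong (c ⊓_) (+-∸-assoc 1 c≤k)

cycleDist-from-top : ∀ {k c} → c ≤ k → cycleDist (suc k) k c ≡ (k ∸ c) ⊓ suc c
cycleDist-from-top {k} {c} c≤k = begin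
  ∣ k - c ∣ ⊓ (suc k ∸ ∣ k - c ∣)   ≡⟨ cong (λ t → t ⊓ (suc k ∸ t)) (m≤n⇒∣n-m∣≡n∸m c≤k) ⟩
  (k ∸ c) ⊓ (suc k ∸ (k ∸ c))       ≡⟨ cong ((k ∸ c) ⊓_) (+-∸-assoc 1 (m∸n≤m k c)) ⟩
  (k ∸ c) ⊓ suc (k ∸ (k ∸ c))       ≡⟨ cong (λ t → (k ∸ c) ⊓ suc t) (m∸[m∸n]≡n c≤k) ⟩
  (k ∸ c) ⊓ suc c                   ∎
  where open ≡-Reasoning

cycleDist-wrap-up : ∀ {k c} → c ≤ k → cycleDist (suc k) 0 c ≤ suc (cycleDist (suc k) k c)
cycleDist-wrap-up {k} {c} c≤k
  rewrite cycleDist-from-0 c≤k | cycleDist-from-top c≤k = ⊓-swap-step c (k ∸ c)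

cycleDist-wrap-down : ∀ {k c} → c ≤ k → cycleDist (suc k) k c ≤ suc (cycleDist (suc k) 0 c)
cycleDist-wrap-down {k} {c} c≤k
  rewrite cycleDist-from-0 c≤k | cycleDist-from-top c≤k = ⊓-swap-step (k ∸ c) c

_++ʷ_ : ∀ {n} {G : Graph n} {x y z l m} → Walk G x y l → Walk G y z m → Walk G x z (l + m)
[]      ++ʷ v = v
(e ∷ u) ++ʷ v = e ∷ (u ++ʷ v)

module _ {n : ℕ} where

  ascending : ∀ m (a b : Fin n) → toℕ a + m ≡ toℕ b → Walk (CycleAdj n) a b m
  ascending zero    a b a+0≡b = subst (λ b → Walk (CycleAdj n) a b 0)
                                  (toℕ-injective (trans (sym (+-identityʳ _)) a+0≡b)) []
  ascending (suc m) a b a+1+m≡b = inj₁ (sym (toℕ-fromℕ< a+1<n)) ∷ ascending m (fromℕ< a+1<n) b next+m≡b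
    where
    1+a+m≡b : suc (toℕ a + m) ≡ toℕ b
    1+a+m≡b = trans (sym (+-suc (toℕ a) m)) a+1+m≡b
    a+1<n : suc (toℕ a) < n
    a+1<n = ≤-<-trans (s≤s (m≤m+n (toℕ a) m)) (subst (_< n) (sym 1+a+m≡b) (toℕ<n b))
    next+m≡b : toℕ (fromℕ< a+1<n) + m ≡ toℕ b
    next+m≡b = trans (cong (_+ m) (toℕ-fromℕ< a+1<n)) 1+a+m≡b

  descending : ∀ m (a b : Fin n) → toℕ b + m ≡ toℕ a → Walk (CycleAdj n) a b m
  descending zero    a b b+0≡a = subst (λ b → Walk (CycleAdj n) a b 0)
                                   (toℕ-injective (sym (trans (sym (+-identityʳ _)) b+0≡a))) []
  descending (suc m) a b b+1+m≡a = inj₂ (inj₁ (trans (cong suc (toℕ-fromℕ< b+m<n)) 1+b+m≡a))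
                                   ∷ descending m (fromℕ< b+m<n) b (sym (toℕ-fromℕ< b+m<n))
    where
    1+b+m≡a : suc (toℕ b + m) ≡ toℕ a
    1+b+m≡a = trans (sym (+-suc (toℕ b) m)) b+1+m≡a
    b+m<n : toℕ b + m < n
    b+m<n = subst (_≤ n) (sym 1+b+m≡a) (≤-trans (n≤1+n _) (toℕ<n a))

-- Length of the walk from a = b + p up to the top k, across the closing edge,
-- and up from 0 to b: it is the long way round, (1 + k) - p.
around-length : ∀ {k} b p → b + p ≤ k → (k ∸ (b + p)) + suc b ≡ suc k ∸ p
around-length {k} b p b+p≤k = sym (begin
  suc k ∸ p                  ≡⟨ cong (λ t → suc t ∸ p) (sym (m+[n∸m]≡n b+p≤k)) ⟩
  suc (b + p + r) ∸ p        ≡⟨ cong (_∸ p) (regroup b p r) ⟩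
  p + (r + suc b) ∸ p        ≡⟨ m+n∸m≡n p (r + suc b) ⟩
  r + suc b                  ∎)
  where
  open ≡-Reasoning
  r : ℕ
  r = k ∸ (b + p)
  regroup : ∀ b p r → suc (b + p + r) ≡ p + (r + suc b)
  regroup = solve-∀

-- Throughout, C is the cycle on the 1 + k vertices 0, …, k, with closing edge k ~ 0.
module Cycle (k : ℕ) where

  n : ℕ
  n = suc k

  C : Graph n
  C = CycleAdj n

  top : Fin n
  top = fromℕ k

  top→0 : C top fzero
  top→0 = inj₂ (inj₂ (inj₂ (refl , cong suc (toℕ-fromℕ k))))

  0→top : C fzero top
  0→top = inj₂ (inj₂ (inj₁ (refl , cong suc (toℕ-fromℕ k))))

  toℕ≤k : (a : Fin n) → toℕ a ≤ k
  toℕ≤k a = s≤s⁻¹ (toℕ<n a)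

  up-to-top : (a : Fin n) → toℕ a + (k ∸ toℕ a) ≡ toℕ top
  up-to-top a = trans (m+[n∸m]≡n (toℕ≤k a)) (sym (toℕ-fromℕ k))

  direct-walk : ∀ a b → Walk C a b ∣ toℕ a - toℕ b ∣
  direct-walk a b with ∣-∣-cases (toℕ a) (toℕ b)
  ... | inj₁ a≡b+p = descending _ a b (sym a≡b+p)
  ... | inj₂ b≡a+p = ascending _ a b (sym b≡a+p)

  around-walk : ∀ a b → Walk C a b (n ∸ ∣ toℕ a - toℕ b ∣)
  around-walk a b with ∣-∣-cases (toℕ a) (toℕ b)
  ... | inj₁ a≡b+p = subst (Walk C a b) length-ok
          (ascending _ a top (up-to-top a) ++ʷ (top→0 ∷ ascending (toℕ b) fzero b refl))
    where
    length-ok : (k ∸ toℕ a) + suc (toℕ b) ≡ n ∸ ∣ toℕ a - toℕ b ∣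
    length-ok = trans (cong (λ t → (k ∸ t) + suc (toℕ b)) a≡b+p)
                      (around-length (toℕ b) _ (subst (_≤ k) a≡b+p (toℕ≤k a)))
  ... | inj₂ b≡a+p = subst (Walk C a b) length-ok
          (descending (toℕ a) a fzero refl ++ʷ (0→top ∷ descending _ top b (up-to-top b)))
    where
    length-ok : toℕ a + suc (k ∸ toℕ b) ≡ n ∸ ∣ toℕ a - toℕ b ∣
    length-ok = begin
      toℕ a + suc (k ∸ toℕ b)  ≡⟨ +-suc (toℕ a) (k ∸ toℕ b) ⟩
      suc (toℕ a + (k ∸ toℕ b)) ≡⟨ cong suc (+-comm (toℕ a) (k ∸ toℕ b)) ⟩
      suc (k ∸ toℕ b + toℕ a)   ≡⟨ sym (+-suc (k ∸ toℕ b) (toℕ a)) ⟩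
      (k ∸ toℕ b) + suc (toℕ a) ≡⟨ cong (λ t → (k ∸ t) + suc (toℕ a)) b≡a+p ⟩
      (k ∸ (toℕ a + _)) + suc (toℕ a) ≡⟨ around-length (toℕ a) _ (subst (_≤ k) b≡a+p (toℕ≤k b)) ⟩
      n ∸ ∣ toℕ a - toℕ b ∣     ∎
      where open ≡-Reasoning

  shortest-walk : ∀ a b → Walk C a b (cycleDist n (toℕ a) (toℕ b))
  shortest-walk a b with ⊓-sel ∣ toℕ a - toℕ b ∣ (n ∸ ∣ toℕ a - toℕ b ∣)
  ... | inj₁ e = subst (Walk C a b) (sym e) (direct-walk a b)
  ... | inj₂ e = subst (Walk C a b) (sym e) (around-walk a b)

  cycleDist-edge : ∀ {a b} c → C a b → cycleDist n (toℕ a) (toℕ c) ≤ suc (cycleDist n (toℕ b) (toℕ c))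
  cycleDist-edge {a} {b} c (inj₁ 1+a≡b) =
    subst (λ t → cycleDist n (toℕ a) (toℕ c) ≤ suc (cycleDist n t (toℕ c))) 1+a≡b
      (cycleDist-succ n (toℕ a) (toℕ c))
  cycleDist-edge {a} {b} c (inj₂ (inj₁ 1+b≡a)) =
    subst (λ t → cycleDist n t (toℕ c) ≤ suc (cycleDist n (toℕ b) (toℕ c))) 1+b≡a
      (cycleDist-pred n (toℕ b) (toℕ c))
  cycleDist-edge c (inj₂ (inj₂ (inj₁ (a≡0 , 1+b≡n))))
    rewrite a≡0 | suc-injective 1+b≡n = cycleDist-wrap-up (toℕ≤k c)
  cycleDist-edge c (inj₂ (inj₂ (inj₂ (b≡0 , 1+a≡n))))
    rewrite b≡0 | suc-injective 1+a≡n = cycleDist-wrap-down (toℕ≤k c)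

  cycleDist-lower : ∀ {a c m} → Walk C a c m → cycleDist n (toℕ a) (toℕ c) ≤ m
  cycleDist-lower {a} [] = ≤-trans (m⊓n≤m _ _) (≤-reflexive (∣n-n∣≡0 (toℕ a)))
  cycleDist-lower {c = c} (e ∷ w) = ≤-trans (cycleDist-edge c e) (s≤s (cycleDist-lower w))

  cycleDist-isDistance : IsDistance C (λ x y → cycleDist n (toℕ x) (toℕ y))
  cycleDist-isDistance x y = shortest-walk x y , λ m w → cycleDist-lower w

  distance-unique : ∀ d → IsDistance C d → ∀ x y → d x y ≡ cycleDist n (toℕ x) (toℕ y)
  distance-unique d isDist x y =
    ≤-antisym (proj₂ (isDist x y) _ (shortest-walk x y)) (cycleDist-lower (proj₁ (isDist x y)))

double-injective : ∀ x y → 2 * x ≡ 2 * y → x ≡ y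
double-injective x y = *-cancelˡ-≡ x y 2

double-gap : ∀ {n} x y → x < n → 2 * x ≢ 2 * y + n + n
double-gap {n} x y x<n e = m+n≮n y n (subst (_< n) x≡y+n x<n)
  where
  regroup : ∀ y n → 2 * y + n + n ≡ 2 * (y + n)
  regroup = solve-∀
  x≡y+n : x ≡ y + n
  x≡y+n = double-injective x (y + n) (trans e (regroup y n))

equal-arcs : ∀ n {p q} → p ≤ n → q ≤ n → p ⊓ (n ∸ p) ≡ q ⊓ (n ∸ q) → p ≡ q ⊎ p + q ≡ n
equal-arcs n {p} {q} p≤n q≤n e with ⊓-sel p (n ∸ p) | ⊓-sel q (n ∸ q)
... | inj₁ e₁ | inj₁ e₂ = inj₁ (trans (sym e₁) (trans e e₂))
... | inj₁ e₁ | inj₂ e₂ = inj₂ (trans (cong (_+ q) (trans (sym e₁) (trans e e₂))) (m∸n+n≡m q≤n))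
... | inj₂ e₁ | inj₁ e₂ = inj₂ (trans (cong (p +_) (sym (trans (sym e₁) (trans e e₂)))) (m+[n∸m]≡n p≤n))
... | inj₂ e₁ | inj₂ e₂ = inj₁ (begin
  p                ≡⟨ sym (m∸[m∸n]≡n p≤n) ⟩
  n ∸ (n ∸ p)      ≡⟨ cong (n ∸_) (trans (sym e₁) (trans e e₂)) ⟩
  n ∸ (n ∸ q)      ≡⟨ m∸[m∸n]≡n q≤n ⟩
  q                ∎)
  where open ≡-Reasoning

-- w is a midpoint of a and b on the cycle of length n: w halves one of the
-- two arcs between a and b.  Doubling, 2w is a + b, or a + b shifted by ±n.
data Midpoint (n a b w : ℕ) : Set where
  inner : a + b ≡ 2 * w → Midpoint n a b w
  outer-above : a + b + n ≡ 2 * w → Midpoint n a b w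
  outer-below : a + b ≡ 2 * w + n → Midpoint n a b w

gaps⇒midpoint : ∀ {n a b w p q} → a < n → b < n → a ≢ b →
                a ≡ w + p ⊎ w ≡ a + p → b ≡ w + q ⊎ w ≡ b + q →
                p ≡ q ⊎ p + q ≡ n → Midpoint n a b w
gaps⇒midpoint a<n b<n a≢b (inj₁ refl) (inj₁ refl) (inj₁ refl) = contradiction refl a≢b
gaps⇒midpoint {b = b} {p = p} a<n b<n a≢b (inj₁ refl) (inj₂ refl) (inj₁ refl) = inner (eq b p)
  where eq : ∀ b p → b + p + p + b ≡ 2 * (b + p)
        eq = solve-∀
gaps⇒midpoint {a = a} {p = p} a<n b<n a≢b (inj₂ refl) (inj₁ refl) (inj₁ refl) = inner (eq a p)
  where eq : ∀ a p → a + (a + p + p) ≡ 2 * (a + p)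
        eq = solve-∀
gaps⇒midpoint {a = a} {b} {p = p} a<n b<n a≢b (inj₂ refl) (inj₂ a+p≡b+p) (inj₁ refl) =
  contradiction (+-cancelʳ-≡ p a b a+p≡b+p) a≢b
gaps⇒midpoint {w = w} {p} {q} a<n b<n a≢b (inj₁ refl) (inj₁ refl) (inj₂ refl) = outer-below (eq w p q)
  where eq : ∀ w p q → w + p + (w + q) ≡ 2 * w + (p + q)
        eq = solve-∀
gaps⇒midpoint {b = b} {p = p} {q} a<n b<n a≢b (inj₁ refl) (inj₂ refl) (inj₂ refl) =
  contradiction (subst (_< p + q) (eq b p q) a<n) (m+n≮m (p + q) b)
  where eq : ∀ b p q → b + q + p ≡ p + q + b
        eq = solve-∀
gaps⇒midpoint {a = a} {p = p} {q} a<n b<n a≢b (inj₂ refl) (inj₁ refl) (inj₂ refl) =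
  contradiction (subst (_< p + q) (eq a p q) b<n) (m+n≮m (p + q) a)
  where eq : ∀ a p q → a + p + q ≡ p + q + a
        eq = solve-∀
gaps⇒midpoint {a = a} {b} {p = p} {q} a<n b<n a≢b (inj₂ refl) (inj₂ a+p≡b+q) (inj₂ refl) =
  outer-above (begin
    a + b + (p + q)      ≡⟨ regroup a b p q ⟩
    (a + p) + (b + q)    ≡⟨ cong ((a + p) +_) (sym a+p≡b+q) ⟩
    (a + p) + (a + p)    ≡⟨ cong ((a + p) +_) (sym (+-identityʳ (a + p))) ⟩
    2 * (a + p)          ∎)
  where
  open ≡-Reasoning
  regroup : ∀ a b p q → a + b + (p + q) ≡ (a + p) + (b + q)
  regroup = solve-∀

equidistant⇒midpoint : ∀ {n a b w} → a < n → b < n → w < n → a ≢ b →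
                       cycleDist n a w ≡ cycleDist n b w → Midpoint n a b w
equidistant⇒midpoint {n} {a} {b} {w} a<n b<n w<n a≢b e =
  gaps⇒midpoint a<n b<n a≢b (∣-∣-cases a w) (∣-∣-cases b w)
    (equal-arcs n (<⇒≤ (gap<n a<n)) (<⇒≤ (gap<n b<n)) e)
  where
  gap<n : ∀ {c} → c < n → ∣ c - w ∣ < n
  gap<n {c} c<n = ≤-<-trans (∣m-n∣≤m⊔n c w) (⊔-lub c<n w<n)

Antipodal : ℕ → ℕ → ℕ → Set
Antipodal n u v = 2 * u + n ≡ 2 * v ⊎ 2 * v + n ≡ 2 * u

midpoints-antipodal : ∀ {n a b} w₁ w₂ → w₁ < n → w₂ < n →
                      Midpoint n a b w₁ → Midpoint n a b w₂ → w₁ ≡ w₂ ⊎ Antipodal n w₁ w₂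
midpoints-antipodal w₁ w₂ _ _ (inner e₁) (inner e₂) = inj₁ (double-injective w₁ w₂ (trans (sym e₁) e₂))
midpoints-antipodal w₁ w₂ _ _ (outer-above e₁) (outer-above e₂) = inj₁ (double-injective w₁ w₂ (trans (sym e₁) e₂))
midpoints-antipodal {n} w₁ w₂ _ _ (outer-below e₁) (outer-below e₂) =
  inj₁ (double-injective w₁ w₂ (+-cancelʳ-≡ n _ _ (trans (sym e₁) e₂)))
midpoints-antipodal {n} _ _ _ _ (inner e₁) (outer-above e₂) = inj₂ (inj₁ (trans (cong (_+ n) (sym e₁)) e₂))
midpoints-antipodal {n} _ _ _ _ (outer-above e₁) (inner e₂) = inj₂ (inj₂ (trans (cong (_+ n) (sym e₂)) e₁))
midpoints-antipodal _ _ _ _ (inner e₁) (outer-below e₂) = inj₂ (inj₂ (trans (sym e₂) e₁))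
midpoints-antipodal _ _ _ _ (outer-below e₁) (inner e₂) = inj₂ (inj₁ (trans (sym e₁) e₂))
midpoints-antipodal {n} w₁ w₂ w₁<n _ (outer-above e₁) (outer-below e₂) =
  ⊥-elim (double-gap w₁ w₂ w₁<n (trans (sym e₁) (cong (_+ n) e₂)))
midpoints-antipodal {n} w₁ w₂ _ w₂<n (outer-below e₁) (outer-above e₂) =
  ⊥-elim (double-gap w₂ w₁ w₂<n (trans (sym e₂) (cong (_+ n) e₁)))

odd-no-antipodes : ∀ {n m} u v → n ≡ 2 * m + 1 → ¬ Antipodal n u v
odd-no-antipodes {m = m} u v refl (inj₁ e) = even≢odd v (u + m) (sym (trans (regroup u m) e))
  where
  regroup : ∀ u m → suc (2 * (u + m)) ≡ 2 * u + (2 * m + 1)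
  regroup = solve-∀
odd-no-antipodes {m = m} u v refl (inj₂ e) = odd-no-antipodes {m = m} v u refl (inj₁ e)

antipode-unique : ∀ {n} u v w → v < n → w < n → Antipodal n u v → Antipodal n u w → v ≡ w
antipode-unique _ v w _ _ (inj₁ e₁) (inj₁ e₂) = double-injective v w (trans (sym e₁) e₂)
antipode-unique {n} _ v w _ _ (inj₂ e₁) (inj₂ e₂) = double-injective v w (+-cancelʳ-≡ n _ _ (trans e₁ (sym e₂)))
antipode-unique {n} u v w v<n _ (inj₁ e₁) (inj₂ e₂) = ⊥-elim (double-gap v w v<n (trans (sym e₁) (cong (_+ n) (sym e₂))))
antipode-unique {n} u v w _ w<n (inj₂ e₁) (inj₁ e₂) = ⊥-elim (double-gap w v w<n (trans (sym e₂) (cong (_+ n) (sym e₁))))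

odd-midpoint-unique : ∀ {n a b} m w₁ w₂ → n ≡ 2 * m + 1 → w₁ < n → w₂ < n →
                      Midpoint n a b w₁ → Midpoint n a b w₂ → w₁ ≡ w₂
odd-midpoint-unique m w₁ w₂ odd w₁<n w₂<n mid₁ mid₂ with midpoints-antipodal w₁ w₂ w₁<n w₂<n mid₁ mid₂
... | inj₁ w₁≡w₂ = w₁≡w₂
... | inj₂ anti  = ⊥-elim (odd-no-antipodes {m = m} w₁ w₂ odd anti)

midpoints-at-most-two : ∀ {n a b} w₁ w₂ w₃ → w₁ < n → w₂ < n → w₃ < n →
                        Midpoint n a b w₁ → Midpoint n a b w₂ → Midpoint n a b w₃ →
                        w₁ ≡ w₂ ⊎ w₁ ≡ w₃ ⊎ w₂ ≡ w₃
midpoints-at-most-two w₁ w₂ w₃ w₁<n w₂<n w₃<n mid₁ mid₂ mid₃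
  with midpoints-antipodal w₁ w₂ w₁<n w₂<n mid₁ mid₂ | midpoints-antipodal w₁ w₃ w₁<n w₃<n mid₁ mid₃
... | inj₁ w₁≡w₂ | _          = inj₁ w₁≡w₂
... | inj₂ _     | inj₁ w₁≡w₃ = inj₂ (inj₁ w₁≡w₃)
... | inj₂ anti₂ | inj₂ anti₃ = inj₂ (inj₂ (antipode-unique w₁ w₂ w₃ w₂<n w₃<n anti₂ anti₃))

AtMostOne : ∀ {a p} {A : Set a} → Pred A p → Set _
AtMostOne {A = A} P = ∀ (x y : A) → P x → P y → x ≡ y

AtMostTwo : ∀ {a p} {A : Set a} → Pred A p → Set _
AtMostTwo {A = A} P = ∀ (x y z : A) → P x → P y → P z → x ≡ y ⊎ x ≡ z ⊎ y ≡ z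

module _ {a} {A : Set a} where

  member⇒length≥1 : ∀ {x : A} {ys} → x ∈ ys → 1 ≤ length ys
  member⇒length≥1 (here _)  = s≤s z≤n
  member⇒length≥1 (there _) = s≤s z≤n

  members⇒length≥2 : ∀ {x y : A} {ys} → x ∈ ys → y ∈ ys → x ≢ y → 2 ≤ length ys
  members⇒length≥2 {ys = _ ∷ []} (here refl) (here refl) x≢y = contradiction refl x≢y
  members⇒length≥2 {ys = _ ∷ _ ∷ _} _ _ _ = s≤s (s≤s z≤n)

  unique-length≤1 : ∀ {p} {P : Pred A p} {ys} → Unique ys → All P ys → AtMostOne P → length ys ≤ 1
  unique-length≤1 {ys = []}        _                _                  _   = z≤n
  unique-length≤1 {ys = _ ∷ []}    _                _                  _   = s≤s z≤n
  unique-length≤1 {ys = y ∷ z ∷ _} ((y≢z ∷ _) ∷ _) (py ∷ pz ∷ _) one = contradiction (one y z py pz) y≢z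

  unique-length≤2 : ∀ {p} {P : Pred A p} {ys} → Unique ys → All P ys → AtMostTwo P → length ys ≤ 2
  unique-length≤2 {ys = []}            _ _ _ = z≤n
  unique-length≤2 {ys = _ ∷ []}        _ _ _ = s≤s z≤n
  unique-length≤2 {ys = _ ∷ _ ∷ []}    _ _ _ = s≤s (s≤s z≤n)
  unique-length≤2 {ys = x ∷ y ∷ z ∷ _} ((x≢y ∷ x≢z ∷ _) ∷ (y≢z ∷ _) ∷ _) (px ∷ py ∷ pz ∷ _) two
    with two x y z px py pz
  ... | inj₁ x≡y        = contradiction x≡y x≢y
  ... | inj₂ (inj₁ x≡z) = contradiction x≡z x≢z
  ... | inj₂ (inj₂ y≡z) = contradiction y≡z y≢z

  module _ {p} {P : Pred A p} (P? : Decidable P) where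

    length-filter+∁ : ∀ xs → length (filter P? xs) + length (filter (∁? P?) xs) ≡ length xs
    length-filter+∁ []       = refl
    length-filter+∁ (x ∷ xs) with P? x
    ... | yes _ = cong suc (length-filter+∁ xs)
    ... | no  _ = trans (+-suc _ _) (cong suc (length-filter+∁ xs))

    length-filter≡ : ∀ xs → length (filter P? xs) ≡ length xs ∸ length (filter (∁? P?) xs)
    length-filter≡ xs = trans (sym (m+n∸n≡m _ (length (filter (∁? P?) xs))))
                              (cong (_∸ length (filter (∁? P?) xs)) (length-filter+∁ xs))

module _ {n : ℕ} (d : Fin n → Fin n → ℕ) where

  Equidistant : Fin n → Fin n → Pred (Fin n) _
  Equidistant x y w = d x w ≡ d y w

  resolves? : (S : Subset n) (x y : Fin n) → Decidable (λ w → (w ∈ₛ S) × ¬ Equidistant x y w)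
  resolves? S x y w = (w ∈? S) ×-dec ¬? (d x w ≟ d y w)

  unresolved : Subset n → Fin n → Fin n → List (Fin n)
  unresolved S x y = filter (∁? (resolves? S x y)) (allFin n)

  #resolving≡ : ∀ S x y → #resolving d S x y ≡ n ∸ length (unresolved S x y)
  #resolving≡ S x y = trans (length-filter≡ (resolves? S x y) (allFin n))
                            (cong (_∸ length (unresolved S x y)) (length-tabulate (λ w → w)))

  equidistant∈unresolved : ∀ S {x y w} → Equidistant x y w → w ∈ unresolved S x y
  equidistant∈unresolved S {x} {y} eq = ∈-filter⁺ (∁? (resolves? S x y)) (∈-allFin _) (λ r → proj₂ r eq)

  unresolved-equidistant : ∀ {x y w} → ∁ (λ w → (w ∈ₛ ⊤) × ¬ Equidistant x y w) w → Equidistant x y w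
  unresolved-equidistant {x} {y} {w} ¬r = decidable-stable (d x w ≟ d y w) (λ ne → ¬r (∈⊤ , ne))

  #unresolved≤1 : ∀ {x y} → AtMostOne (Equidistant x y) → length (unresolved ⊤ x y) ≤ 1
  #unresolved≤1 {x} {y} one =
    unique-length≤1 (filter⁺ (∁? (resolves? ⊤ x y)) (allFin⁺ n)) (all-filter (∁? (resolves? ⊤ x y)) (allFin n))
      (λ u v ¬ru ¬rv → one u v (unresolved-equidistant ¬ru) (unresolved-equidistant ¬rv))

  #unresolved≤2 : ∀ {x y} → AtMostTwo (Equidistant x y) → length (unresolved ⊤ x y) ≤ 2
  #unresolved≤2 {x} {y} two =
    unique-length≤2 (filter⁺ (∁? (resolves? ⊤ x y)) (allFin⁺ n)) (all-filter (∁? (resolves? ⊤ x y)) (allFin n))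
      (λ u v w ¬ru ¬rv ¬rw → two u v w (unresolved-equidistant ¬ru) (unresolved-equidistant ¬rv)
                                        (unresolved-equidistant ¬rw))

  k-metric-dimensional : ∀ r x y → x ≢ y → (∀ S → r ≤ length (unresolved S x y)) →
                         (∀ u v → u ≢ v → length (unresolved ⊤ u v) ≤ r) →
                         IsKMetricDimensional d (n ∸ r)
  k-metric-dimensional r x y x≢y many few = (⊤ , ⊤-generator) , bounded
    where
    ⊤-generator : IsKMetricGenerator d (n ∸ r) ⊤
    ⊤-generator u v u≢v = subst (n ∸ r ≤_) (sym (#resolving≡ ⊤ u v)) (∸-monoʳ-≤ n (few u v u≢v))
    bounded : ∀ k S → IsKMetricGenerator d k S → k ≤ n ∸ r
    bounded k S gen = ≤-trans (gen x y x≢y) (subst (_≤ n ∸ r) (sym (#resolving≡ S x y)) (∸-monoʳ-≤ n (many S)))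

-- On the cycle of even length 2(1 + m), both 0 and 2 are at distance m from 2 + m,
-- the antipode of 1.
antipode-of-1-equidistant : ∀ m → cycleDist (2 * suc m) 0 (2 + m) ≡ cycleDist (2 * suc m) 2 (2 + m)
antipode-of-1-equidistant m = begin
  (2 + m) ⊓ (2 * suc m ∸ (2 + m))   ≡⟨ cong ((2 + m) ⊓_) (∸-of-sum (2 + m) m (split₁ m)) ⟩
  (2 + m) ⊓ m                       ≡⟨ ⊓-comm (2 + m) m ⟩
  m ⊓ (2 + m)                       ≡⟨ cong (m ⊓_) (sym (∸-of-sum m (2 + m) (split₂ m))) ⟩
  m ⊓ (2 * suc m ∸ m)               ∎
  where
  open ≡-Reasoning
  ∸-of-sum : ∀ p q {s} → s ≡ p + q → s ∸ p ≡ q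
  ∸-of-sum p q refl = m+n∸m≡n p q
  split₁ : ∀ m → 2 * suc m ≡ (2 + m) + m
  split₁ = solve-∀
  split₂ : ∀ m → 2 * suc m ≡ m + (2 + m)
  split₂ = solve-∀

module CycleEquidistance (k : ℕ) (d : Fin (suc k) → Fin (suc k) → ℕ)
                         (isDist : IsDistance (CycleAdj (suc k)) d) where
  open Cycle k

  equidistant⇒Midpoint : ∀ {x y} → x ≢ y → ∀ w → Equidistant d x y w → Midpoint n (toℕ x) (toℕ y) (toℕ w)
  equidistant⇒Midpoint {x} {y} x≢y w eq =
    equidistant⇒midpoint (toℕ<n x) (toℕ<n y) (toℕ<n w) (λ e → x≢y (toℕ-injective e))
      (trans (sym (distance-unique d isDist x w)) (trans eq (distance-unique d isDist y w)))

  equidistant-odd : ∀ m → n ≡ 2 * m + 1 → ∀ x y → x ≢ y → AtMostOne (Equidistant d x y)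
  equidistant-odd m odd x y x≢y w₁ w₂ eq₁ eq₂ = toℕ-injective
    (odd-midpoint-unique m (toℕ w₁) (toℕ w₂) odd (toℕ<n w₁) (toℕ<n w₂)
      (equidistant⇒Midpoint x≢y w₁ eq₁) (equidistant⇒Midpoint x≢y w₂ eq₂))

  equidistant-at-most-two : ∀ x y → x ≢ y → AtMostTwo (Equidistant d x y)
  equidistant-at-most-two x y x≢y w₁ w₂ w₃ eq₁ eq₂ eq₃ =
    ⊎-map toℕ-injective (⊎-map toℕ-injective toℕ-injective)
      (midpoints-at-most-two (toℕ w₁) (toℕ w₂) (toℕ w₃) (toℕ<n w₁) (toℕ<n w₂) (toℕ<n w₃)
        (equidistant⇒Midpoint x≢y w₁ eq₁) (equidistant⇒Midpoint x≢y w₂ eq₂) (equidistant⇒Midpoint x≢y w₃ eq₃))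

-- The cycle of order 3 + j: vertex 1 is equidistant from 0 and 2, so the pair
-- {0, 2} witnesses the upper bounds on k.
module CycleOfOrder≥3 (j : ℕ) (d : Fin (3 + j) → Fin (3 + j) → ℕ)
                      (isDist : IsDistance (CycleAdj (3 + j)) d) where
  open Cycle (2 + j)
  open CycleEquidistance (2 + j) d isDist

  v₀ v₁ v₂ : Fin (3 + j)
  v₀ = fzero
  v₁ = fsuc fzero
  v₂ = fsuc (fsuc fzero)

  v₁-equidistant : Equidistant d v₀ v₂ v₁
  v₁-equidistant = trans (distance-unique d isDist v₀ v₁) (sym (distance-unique d isDist v₂ v₁))

  odd-cycle : Σ ℕ (λ m → 3 + j ≡ 2 * m + 1) → IsKMetricDimensional d (3 + j ∸ 1)
  odd-cycle (m , odd) = k-metric-dimensional d 1 v₀ v₂ (λ ())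
    (λ S → member⇒length≥1 (equidistant∈unresolved d S v₁-equidistant))
    (λ u v u≢v → #unresolved≤1 d (equidistant-odd m odd u v u≢v))

  -- For even order 2(2 + t) the antipode 3 + t of vertex 1 is a second equidistant vertex.
  even-cycle : Σ ℕ (λ m → 3 + j ≡ 2 * m) → IsKMetricDimensional d (3 + j ∸ 2)
  even-cycle (zero , ())
  even-cycle (suc zero , ())
  even-cycle (suc (suc t) , even) = k-metric-dimensional d 2 v₀ v₂ (λ ())
    (λ S → members⇒length≥2 (equidistant∈unresolved d S v₁-equidistant)
                            (equidistant∈unresolved d S antipode-equidistant) v₁≢antipode)
    (λ u v u≢v → #unresolved≤2 d (equidistant-at-most-two u v u≢v))
    where
    antipode<n : 3 + t < 3 + j
    antipode<n = subst (3 + t <_) (sym even) (subst (4 + t ≤_) (sym (split t)) (m≤m+n (4 + t) t))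
      where split : ∀ t → 2 * (2 + t) ≡ 4 + t + t
            split = solve-∀

    antipode : Fin (3 + j)
    antipode = fromℕ< antipode<n

    v₁≢antipode : v₁ ≢ antipode
    v₁≢antipode e with trans (cong toℕ e) (toℕ-fromℕ< antipode<n)
    ... | ()

    antipode-equidistant : Equidistant d v₀ v₂ antipode
    antipode-equidistant = begin
      d v₀ antipode                 ≡⟨ distance-unique d isDist v₀ antipode ⟩
      cycleDist n 0 (toℕ antipode)  ≡⟨ cong (cycleDist n 0) (toℕ-fromℕ< antipode<n) ⟩
      cycleDist n 0 (3 + t)         ≡⟨ subst (λ N → cycleDist N 0 (3 + t) ≡ cycleDist N 2 (3 + t)) (sym even)
                                             (antipode-of-1-equidistant (suc t)) ⟩
      cycleDist n 2 (3 + t)         ≡⟨ cong (cycleDist n 2) (sym (toℕ-fromℕ< antipode<n)) ⟩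
      cycleDist n 2 (toℕ antipode)  ≡⟨ sym (distance-unique d isDist v₂ antipode) ⟩
      d v₂ antipode                 ∎
      where open ≡-Reasoning

proposition7 : (n : ℕ) → 3 ≤ n →
    Σ (Fin n → Fin n → ℕ) (IsDistance (CycleAdj n))
    × (∀ (d : Fin n → Fin n → ℕ) → IsDistance (CycleAdj n) d →
    (Σ ℕ (λ m → n ≡ 2 * m + 1) → IsKMetricDimensional d (n ∸ 1))
    × (Σ ℕ (λ m → n ≡ 2 * m) → IsKMetricDimensional d (n ∸ 2)))
proposition7 (suc (suc (suc j))) (s≤s (s≤s (s≤s z≤n))) =
  ((λ x y → cycleDist (3 + j) (toℕ x) (toℕ y)) , Cycle.cycleDist-isDistance (2 + j)) ,
  λ d isDist → CycleOfOrder≥3.odd-cycle j d isDist , CycleOfOrder≥3.even-cycle j d isDist
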